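{- For nonnegative integers $n$ and $m$, the following results hold: (1) If either $n$ or $m$ (or both) is even, then $(n,m) = H_{n+m}$. (2) If both $n$ and $m$ are odd, then $(n,m) = H_{n+m-2}$.
   Context: Partisan chocolate game: a component is a rectangular chocolate bar of square cells; the bottom-left cell is poisoned (black), the others are colored blue and red in checkerboard fashion with the cells orthogonally adjacent to the poisoned one blue. Left may cut along a vertical line if the top square of the column immediately to the right of that line is blue, or along a horizontal line if the rightmost square of the row just above that line is blue; Right may make the same moves when the corresponding square is red. After a cut, the player eats the portion not containing the poisoned square. Normal play. The bar with $n+1$ columns and $m+1$ rows is denoted $(n,m)$ (columns and rows indexed from 0). $H_k=\frac{2^k-(-1)^k}{3\times 2^{k-1}}$ is the value of the alternating blue-red hackenbush string of size $k$ with a blue edge at the base. Here $=$ denotes game equivalence. -}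

module Defs where

open import Data.Nat using (ℕ; zero; suc; _+_; _<_; _%_)
open import Data.Product using (Σ; _×_; _,_)
open import Data.Sum using (_⊎_; inj₁; inj₂)
open import Data.Empty using (⊥)
open import Relation.Nullary using (¬_)
open import Relation.Binary.PropositionalEquality using (_≡_)

-- Short partisan games (Conway), as well-founded trees of options.

data Game : Set₁ where
  game : (L : Set) → (L → Game) → (R : Set) → (R → Game) → Game

infix 4 _≤G_ _≈G_
_≤G_ : Game → Game → Set
game GL gl GR gr ≤G game HL hl HR hr =
  ((i : GL) → ¬ (game HL hl HR hr ≤G gl i)) ×
  ((j : HR) → ¬ (hr j ≤G game GL gl GR gr))

_≈G_ : Game → Game → Set
G ≈G H = (G ≤G H) × (H ≤G G)

-- Cell (x , y) = column x, row y; (0,0) is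
-- poisoned; the cells orthogonally adjacent to it are blue, and the rest
-- are checkerboard-coloured: blue iff x + y is odd, red iff x + y is even
-- (and (x,y) ≠ (0,0), which is automatic for every cell examined below).

Blue : ℕ → ℕ → Set
Blue x y = (x + y) % 2 ≡ 1

Red : ℕ → ℕ → Set
Red x y = (x + y) % 2 ≡ 0

-- Moves from the bar (n , m) (columns 0..n, rows 0..m):
--  * vertical cut between column i and i+1 (i < n) leaves (i , m); it is
--    decided by the colour of the top square (i+1 , m) of column i+1;
--  * horizontal cut between row j and j+1 (j < m) leaves (n , j); it is
--    decided by the colour of the rightmost square (n , j+1) of row j+1.
LeftMoves : ℕ → ℕ → Set
LeftMoves n m =
  (Σ ℕ λ i → i < n × Blue (suc i) m) ⊎ (Σ ℕ λ j → j < m × Blue n (suc j))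

RightMoves : ℕ → ℕ → Set
RightMoves n m =
  (Σ ℕ λ i → i < n × Red (suc i) m) ⊎ (Σ ℕ λ j → j < m × Red n (suc j))

-- Fuel-driven construction (fuel exceeds n + m, which strictly decreases
-- along every move, so the fuel never runs out on reachable positions).
chocF : ℕ → ℕ → ℕ → Game
chocF zero    n m = game ⊥ (λ ()) ⊥ (λ ())
chocF (suc f) n m =
  game (LeftMoves n m)
       (λ { (inj₁ (i , _)) → chocF f i m ; (inj₂ (j , _)) → chocF f n j })
       (RightMoves n m)
       (λ { (inj₁ (i , _)) → chocF f i m ; (inj₂ (j , _)) → chocF f n j })

chocolate : ℕ → ℕ → Game
chocolate n m = chocF (suc (n + m)) n m

-- Alternating blue-red Hackenbush string of size k with a blue edge at
-- the base.  Edge number e (1 ≤ e ≤ k, counted from the ground) is blue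
-- iff e is odd; cutting it leaves the string of size j = e - 1.  Hence
-- Left moves to size j for every even j < k, Right to every odd j < k.

hackF : ℕ → ℕ → Game
hackF zero    k = game ⊥ (λ ()) ⊥ (λ ())
hackF (suc f) k =
  game (Σ ℕ λ j → j < k × j % 2 ≡ 0) (λ { (j , _) → hackF f j })
       (Σ ℕ λ j → j < k × j % 2 ≡ 1) (λ { (j , _) → hackF f j })

H : ℕ → Game
H k = hackF (suc k) k

-- Say G ∼H k when every Left option of G behaves like some H w below H k,
-- every Right option like some H w above H k, and among these are the
-- canonical options of H k: an even and an odd w with k ≤ 2 + w.  The values
-- H k are ordered with the even-indexed ones increasing and the odd-indexed
-- ones decreasing (towards 2/3), and a joint induction on two such games
-- shows that G ≤ K exactly when their indices are so ordered; so any two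
-- games with G ∼H k are equal.  The bar (n , m)
-- behaves like H of n + m, lowered by 2 when n and m are both odd: Left
-- cuts leave bars of even index and Right cuts bars of odd index, the index
-- strictly drops along cuts preserving its parity, and cutting one or two
-- columns or rows from a suitable side reaches the canonical options.

module Submission where

open import Defs
open import Data.Nat using (ℕ; zero; suc; _+_; _∸_; _*_; _%_; _≤_; _<_; z≤n; s≤s; parity)
open import Data.Nat.Properties hiding (_≟_)
open import Data.Parity.Base as ℙ using (Parity; 0ℙ; 1ℙ; _⁻¹)
open import Data.Parity.Properties as ℙₚ
  using (_≟_; suc-homo-⁻¹; ⁻¹-selfInverse; ⁻¹-involutive; p≢p⁻¹)
open import Data.Product using (Σ; ∃-syntax; _×_; _,_; proj₁)
open import Data.Sum as Sum using (_⊎_; inj₁; inj₂)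
open import Data.Empty using (⊥-elim)
open import Relation.Nullary using (¬_; yes; no; contradiction)
open import Relation.Binary.PropositionalEquality
open import Relation.Binary.Definitions using (tri<; tri≈; tri>)

toℕ : Parity → ℕ
toℕ 0ℙ = 0
toℕ 1ℙ = 1

toℕ-injective : ∀ {p q} → toℕ p ≡ toℕ q → p ≡ q
toℕ-injective {0ℙ} {0ℙ} _ = refl
toℕ-injective {1ℙ} {1ℙ} _ = refl

%2≡toℕ-parity : ∀ n → n % 2 ≡ toℕ (parity n)
%2≡toℕ-parity zero = refl
%2≡toℕ-parity (suc zero) = refl
%2≡toℕ-parity (suc (suc n)) = %2≡toℕ-parity n

parity⇒%2 : ∀ n {p} → parity n ≡ p → n % 2 ≡ toℕ p
parity⇒%2 n e = trans (%2≡toℕ-parity n) (cong toℕ e)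

%2⇒parity : ∀ n {p} → n % 2 ≡ toℕ p → parity n ≡ p
%2⇒parity n e = toℕ-injective (trans (sym (%2≡toℕ-parity n)) e)

parity-suc : ∀ n → parity (suc n) ≡ parity n ⁻¹
parity-suc n = sym (⁻¹-selfInverse (suc-homo-⁻¹ n))

parity-pred : ∀ n {p} → parity (suc n) ≡ p → parity n ≡ p ⁻¹
parity-pred n e = trans (sym (suc-homo-⁻¹ n)) (cong _⁻¹ e)

parity-suc≢ : ∀ n → parity (suc n) ≢ parity n
parity-suc≢ n e = p≢p⁻¹ (parity n) (trans (sym e) (parity-suc n))

≢⇒≡⁻¹ : ∀ {p q : Parity} → p ≢ q → p ≡ q ⁻¹
≢⇒≡⁻¹ {0ℙ} {0ℙ} ne = contradiction refl ne
≢⇒≡⁻¹ {0ℙ} {1ℙ} _ = refl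
≢⇒≡⁻¹ {1ℙ} {0ℙ} _ = refl
≢⇒≡⁻¹ {1ℙ} {1ℙ} ne = contradiction refl ne

≡0ℙ⇒≢1ℙ : ∀ {p : Parity} → p ≡ 0ℙ → p ≢ 1ℙ
≡0ℙ⇒≢1ℙ refl ()

odd⇒0< : ∀ {n} → parity n ≡ 1ℙ → 0 < n
odd⇒0< {suc n} _ = s≤s z≤n

parity-∸2 : ∀ {n} → 2 ≤ n → parity (n ∸ 2) ≡ parity n
parity-∸2 {suc (suc n)} _ = refl
parity-∸2 {suc zero} (s≤s ())

parity-cases : ∀ n m →
               (parity n ≡ 0ℙ ⊎ parity m ≡ 0ℙ) ⊎ (parity n ≡ 1ℙ × parity m ≡ 1ℙ)
parity-cases n m with parity n | parity m
... | 0ℙ | _  = inj₁ (inj₁ refl)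
... | 1ℙ | 0ℙ = inj₁ (inj₂ refl)
... | 1ℙ | 1ℙ = inj₂ (refl , refl)

≡parity∧<2+⇒≤ : ∀ {a w} → parity a ≡ parity w → a < 2 + w → a ≤ w
≡parity∧<2+⇒≤ {a} {w} e a<2+w with m<1+n⇒m<n∨m≡n a<2+w
... | inj₁ a<1+w = ≤-pred a<1+w
... | inj₂ refl = contradiction e (parity-suc≢ w)

-- a ⊑ b  iff  H a ≤ H b
infix 4 _⊑_
data _⊑_ (a b : ℕ) : Set where
  even≤even : parity a ≡ 0ℙ → parity b ≡ 0ℙ → a ≤ b → a ⊑ b
  even⊑odd  : parity a ≡ 0ℙ → parity b ≡ 1ℙ → a ⊑ b
  odd≥odd   : parity a ≡ 1ℙ → parity b ≡ 1ℙ → b ≤ a → a ⊑ b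

⊑-refl : ∀ {a} → a ⊑ a
⊑-refl {a} with parity a in pa
... | 0ℙ = even≤even pa pa ≤-refl
... | 1ℙ = odd≥odd pa pa ≤-refl

⊑-trans : ∀ {a b c} → a ⊑ b → b ⊑ c → a ⊑ c
⊑-trans (even≤even pa _ a≤b) (even≤even _ pc b≤c) = even≤even pa pc (≤-trans a≤b b≤c)
⊑-trans (even≤even pa _ _)   (even⊑odd _ pc)      = even⊑odd pa pc
⊑-trans (even≤even _ pb _)   (odd≥odd qb _ _)     = contradiction qb (≡0ℙ⇒≢1ℙ pb)
⊑-trans (even⊑odd _ qb)      (even≤even pb _ _)   = contradiction qb (≡0ℙ⇒≢1ℙ pb)
⊑-trans (even⊑odd _ qb)      (even⊑odd pb _)      = contradiction qb (≡0ℙ⇒≢1ℙ pb)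
⊑-trans (even⊑odd pa _)      (odd≥odd _ pc _)     = even⊑odd pa pc
⊑-trans (odd≥odd _ qb _)     (even≤even pb _ _)   = contradiction qb (≡0ℙ⇒≢1ℙ pb)
⊑-trans (odd≥odd _ qb _)     (even⊑odd pb _)      = contradiction qb (≡0ℙ⇒≢1ℙ pb)
⊑-trans (odd≥odd pa _ b≤a)   (odd≥odd _ pc c≤b)   = odd≥odd pa pc (≤-trans c≤b b≤a)

⊑-cases : ∀ a b → a ⊑ b ⊎ (b < a × parity b ≡ 0ℙ) ⊎ (a < b × parity a ≡ 1ℙ)
⊑-cases a b with parity a in pa | parity b in pb
... | 0ℙ | 1ℙ = inj₁ (even⊑odd pa pb)
... | 0ℙ | 0ℙ with a ≤? b
...   | yes a≤b = inj₁ (even≤even pa pb a≤b)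
...   | no a≰b  = inj₂ (inj₁ (≰⇒> a≰b , refl))
⊑-cases a b | 1ℙ | 1ℙ with b ≤? a
...   | yes b≤a = inj₁ (odd≥odd pa pb b≤a)
...   | no b≰a  = inj₂ (inj₂ (≰⇒> b≰a , refl))
⊑-cases a b | 1ℙ | 0ℙ with <-cmp a b
...   | tri< a<b _ _ = inj₂ (inj₂ (a<b , refl))
...   | tri≈ _ refl _ = contradiction pa (≡0ℙ⇒≢1ℙ pb)
...   | tri> _ _ b<a = inj₂ (inj₁ (b<a , refl))

even⋢ : ∀ {k w} → parity w ≡ 0ℙ → (parity k ≡ 0ℙ → w < k) → ¬ k ⊑ w
even⋢ _  w<k (even≤even pk _ k≤w) = ≤⇒≯ k≤w (w<k pk)
even⋢ pw _   (even⊑odd _ qw)      = contradiction qw (≡0ℙ⇒≢1ℙ pw)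
even⋢ pw _   (odd≥odd _ qw _)     = contradiction qw (≡0ℙ⇒≢1ℙ pw)

odd⋢ : ∀ {k w} → parity w ≡ 1ℙ → (parity k ≡ 1ℙ → w < k) → ¬ w ⊑ k
odd⋢ qw _   (even≤even pw _ _)  = contradiction qw (≡0ℙ⇒≢1ℙ pw)
odd⋢ qw _   (even⊑odd pw _)     = contradiction qw (≡0ℙ⇒≢1ℙ pw)
odd⋢ _  w<k (odd≥odd _ pk k≤w)  = ≤⇒≯ k≤w (w<k pk)

infix 4 _∼H_
data _∼H_ : Game → ℕ → Set₁ where
  ∼H-intro : ∀ {L R l r k} (wL : L → ℕ) (wR : R → ℕ) →
    (∀ i → l i ∼H wL i) → (∀ j → r j ∼H wR j) →
    (∀ i → ¬ k ⊑ wL i) → (∀ j → ¬ wR j ⊑ k) →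
    (0 < k → ∃[ i ] parity (wL i) ≡ 0ℙ × k ≤ 2 + wL i) →
    (1 < k → ∃[ j ] parity (wR j) ≡ 1ℙ × k ≤ 2 + wR j) →
    game L l R r ∼H k

⊑⇒≤G : ∀ {G K a b} → G ∼H a → K ∼H b → a ⊑ b → G ≤G K
≤G⇒⊑ : ∀ {G K a b} → G ∼H a → K ∼H b → G ≤G K → a ⊑ b
separated⇒≰G : ∀ {G K a b} → G ∼H a → K ∼H b →
               (b < a × parity b ≡ 0ℙ) ⊎ (a < b × parity a ≡ 1ℙ) → ¬ G ≤G K

⊑⇒≤G G∼a@(∼H-intro _ _ gL _ ltL _ _ _) K∼b@(∼H-intro _ _ _ kR _ gtR _ _) a⊑b =
  (λ i K≤l → ltL i (⊑-trans a⊑b (≤G⇒⊑ K∼b (gL i) K≤l))) ,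
  (λ j r≤G → gtR j (⊑-trans (≤G⇒⊑ (kR j) G∼a r≤G) a⊑b))

-- G∼a and K∼b are not split here: the with-function must receive them whole
-- for the termination checker to relate the recursive calls to them.
≤G⇒⊑ {a = a} {b} G∼a K∼b G≤K with ⊑-cases a b
... | inj₁ a⊑b = a⊑b
... | inj₂ gap = ⊥-elim (separated⇒≰G G∼a K∼b gap G≤K)

separated⇒≰G (∼H-intro _ _ gL _ _ _ leftL _) K∼b@(∼H-intro _ _ _ _ _ _ _ _)
             (inj₁ (b<a , pb)) (noL , _) =
  let i , pw , a≤2+w = leftL (≤-<-trans z≤n b<a)
      b≤w = ≡parity∧<2+⇒≤ (trans pb (sym pw)) (<-≤-trans b<a a≤2+w)
  in  noL i (⊑⇒≤G K∼b (gL i) (even≤even pb pw b≤w))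
separated⇒≰G G∼a@(∼H-intro _ _ _ _ _ _ _ _) (∼H-intro _ _ _ kR _ _ _ rightR)
             (inj₂ (a<b , pa)) (_ , noR) =
  let j , pw , b≤2+w = rightR (≤-<-trans (odd⇒0< pa) a<b)
      a≤w = ≡parity∧<2+⇒≤ (trans pa (sym pw)) (<-≤-trans a<b b≤2+w)
  in  noR j (⊑⇒≤G (kR j) G∼a (odd≥odd pw pa a≤w))

∼H-≈G : ∀ {G K k} → G ∼H k → K ∼H k → G ≈G K
∼H-≈G G∼k K∼k = ⊑⇒≤G G∼k K∼k ⊑-refl , ⊑⇒≤G K∼k G∼k ⊑-refl

nearestBelow : ∀ q k → toℕ q < k → ∃[ j ] j < k × parity j ≡ q × k ≤ 2 + j
nearestBelow q (suc k) lt with parity k ≟ q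
... | yes e = k , ≤-refl , e , n≤1+n (suc k)
nearestBelow 0ℙ (suc zero) _ | no ne = contradiction refl ne
nearestBelow 1ℙ (suc zero) (s≤s ()) | no _
nearestBelow q (suc (suc k)) _ | no ne =
  k , n≤1+n (suc k) , trans (parity-pred k (≢⇒≡⁻¹ ne)) (⁻¹-involutive q) , ≤-refl

hackF-∼H : ∀ f k → k < f → hackF f k ∼H k
hackF-∼H (suc f) k (s≤s k≤f) =
  ∼H-intro proj₁ proj₁
    (λ { (j , j<k , _) → hackF-∼H f j (<-≤-trans j<k k≤f) })
    (λ { (j , j<k , _) → hackF-∼H f j (<-≤-trans j<k k≤f) })
    (λ { (j , j<k , e) → even⋢ (%2⇒parity j e) (λ _ → j<k) })
    (λ { (j , j<k , e) → odd⋢ (%2⇒parity j e) (λ _ → j<k) })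
    (λ 0<k → let j , j<k , pj , k≤2+j = nearestBelow 0ℙ k 0<k
             in  (j , j<k , parity⇒%2 j pj) , pj , k≤2+j)
    (λ 1<k → let j , j<k , pj , k≤2+j = nearestBelow 1ℙ k 1<k
             in  (j , j<k , parity⇒%2 j pj) , pj , k≤2+j)

H-∼H : ∀ k → H k ∼H k
H-∼H k = hackF-∼H (suc k) k ≤-refl

chocIndex : ℕ → ℕ → ℕ
chocIndex n m = n + m ∸ 2 * toℕ (parity n ℙ.* parity m)

chocIndex-≡+ : ∀ n m → parity n ≡ 0ℙ ⊎ parity m ≡ 0ℙ → chocIndex n m ≡ n + m
chocIndex-≡+ n m (inj₁ pn) rewrite pn = refl
chocIndex-≡+ n m (inj₂ pm) rewrite pm with parity n
... | 0ℙ = refl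
... | 1ℙ = refl

chocIndex-≡+∸2 : ∀ n m → parity n ≡ 1ℙ → parity m ≡ 1ℙ → chocIndex n m ≡ n + m ∸ 2
chocIndex-≡+∸2 n m pn pm rewrite pn | pm = refl

2≤odd+odd : ∀ n m → parity n ≡ 1ℙ → parity m ≡ 1ℙ → 2 ≤ n + m
2≤odd+odd n m pn pm = +-mono-≤ (odd⇒0< {n} pn) (odd⇒0< {m} pm)

chocIndex-≤+ : ∀ n m → chocIndex n m ≤ n + m
chocIndex-≤+ n m = m∸n≤m (n + m) (2 * toℕ (parity n ℙ.* parity m))

chocIndex-comm : ∀ n m → chocIndex n m ≡ chocIndex m n
chocIndex-comm n m =
  cong₂ (λ s p → s ∸ 2 * toℕ p) (+-comm n m) (ℙₚ.*-comm (parity n) (parity m))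

chocIndex-parity : ∀ n m → parity (chocIndex n m) ≡ parity (n + m)
chocIndex-parity n m with parity-cases n m
... | inj₁ h = cong parity (chocIndex-≡+ n m h)
... | inj₂ (pn , pm) =
  trans (cong parity (chocIndex-≡+∸2 n m pn pm)) (parity-∸2 (2≤odd+odd n m pn pm))

chocIndex-+2ˡ : ∀ n m → chocIndex (suc (suc n)) m ≡ 2 + chocIndex n m
chocIndex-+2ˡ n m with parity-cases n m
... | inj₁ h = trans (chocIndex-≡+ (suc (suc n)) m h) (cong (2 +_) (sym (chocIndex-≡+ n m h)))
... | inj₂ (pn , pm) = begin
  chocIndex (suc (suc n)) m ≡⟨ chocIndex-≡+∸2 (suc (suc n)) m pn pm ⟩
  n + m                     ≡⟨ sym (m+[n∸m]≡n (2≤odd+odd n m pn pm)) ⟩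
  2 + (n + m ∸ 2)           ≡⟨ cong (2 +_) (sym (chocIndex-≡+∸2 n m pn pm)) ⟩
  2 + chocIndex n m         ∎
  where open ≡-Reasoning

chocIndex-+2ʳ : ∀ n m → chocIndex n (suc (suc m)) ≡ 2 + chocIndex n m
chocIndex-+2ʳ n m = begin
  chocIndex n (suc (suc m)) ≡⟨ chocIndex-comm n (suc (suc m)) ⟩
  chocIndex (suc (suc m)) n ≡⟨ chocIndex-+2ˡ m n ⟩
  2 + chocIndex m n         ≡⟨ cong (2 +_) (chocIndex-comm m n) ⟩
  2 + chocIndex n m         ∎
  where open ≡-Reasoning

chocIndex-<-+2ˡ : ∀ n m → chocIndex n m < chocIndex (suc (suc n)) m
chocIndex-<-+2ˡ n m =
  subst (chocIndex n m <_) (sym (chocIndex-+2ˡ n m)) (m<n⇒m<1+n (n<1+n (chocIndex n m)))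

chocIndex-<ˡ : ∀ {i n} m → i < n → parity (i + m) ≡ parity (n + m) →
               chocIndex i m < chocIndex n m
chocIndex-<ˡ {n = suc zero} m (s≤s z≤n) e = contradiction (sym e) (parity-suc≢ m)
chocIndex-<ˡ {i} {suc (suc n)} m i<2+n e with m<1+n⇒m<n∨m≡n i<2+n
... | inj₂ refl = contradiction e (parity-suc≢ (n + m))
... | inj₁ i<1+n with m<1+n⇒m<n∨m≡n i<1+n
...   | inj₂ refl = chocIndex-<-+2ˡ n m
...   | inj₁ i<n = <-trans (chocIndex-<ˡ m i<n e) (chocIndex-<-+2ˡ n m)

chocIndex-<ʳ : ∀ {j m} n → j < m → parity (n + j) ≡ parity (n + m) →
               chocIndex n j < chocIndex n m
chocIndex-<ʳ {j} {m} n j<m e =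
  subst₂ _<_ (chocIndex-comm j n) (chocIndex-comm m n)
    (chocIndex-<ˡ n j<m (trans (cong parity (+-comm j n)) (trans e (cong parity (+-comm n m)))))

chocIndex-sucˡ-≤ : ∀ n m → parity n ≡ 0ℙ ⊎ parity m ≡ 0ℙ →
                   chocIndex (suc n) m ≤ suc (chocIndex n m)
chocIndex-sucˡ-≤ n m h = begin
  chocIndex (suc n) m ≤⟨ chocIndex-≤+ (suc n) m ⟩
  suc (n + m)         ≡⟨ cong suc (sym (chocIndex-≡+ n m h)) ⟩
  suc (chocIndex n m) ∎
  where open ≤-Reasoning

chocIndex-sucʳ-≤ : ∀ n m → parity n ≡ 0ℙ ⊎ parity m ≡ 0ℙ →
                   chocIndex n (suc m) ≤ suc (chocIndex n m)
chocIndex-sucʳ-≤ n m h = begin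
  chocIndex n (suc m) ≤⟨ chocIndex-≤+ n (suc m) ⟩
  n + suc m           ≡⟨ +-suc n m ⟩
  suc (n + m)         ≡⟨ cong suc (sym (chocIndex-≡+ n m h)) ⟩
  suc (chocIndex n m) ∎
  where open ≤-Reasoning

-- Cuts decided by a square whose coordinate sum has parity p:
-- LeftMoves n m is Cut 1ℙ n m and RightMoves n m is Cut 0ℙ n m.
Cut : Parity → ℕ → ℕ → Set
Cut p n m =
  (Σ ℕ λ i → i < n × (suc i + m) % 2 ≡ toℕ p) ⊎
  (Σ ℕ λ j → j < m × (n + suc j) % 2 ≡ toℕ p)

targetIndex : ∀ {p n m} → Cut p n m → ℕ
targetIndex {m = m} (inj₁ (i , _)) = chocIndex i m
targetIndex {n = n} (inj₂ (j , _)) = chocIndex n j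

parity⇒colour : ∀ x {p} → parity x ≡ p ⁻¹ → suc x % 2 ≡ toℕ p
parity⇒colour x {p} e =
  parity⇒%2 (suc x) (trans (parity-suc x) (trans (cong _⁻¹ e) (⁻¹-involutive p)))

colour⇒parity : ∀ x {p} → suc x % 2 ≡ toℕ p → parity x ≡ p ⁻¹
colour⇒parity x e = parity-pred x (%2⇒parity (suc x) e)

colourʰ⇒parity : ∀ n j {p} → (n + suc j) % 2 ≡ toℕ p → parity (n + j) ≡ p ⁻¹
colourʰ⇒parity n j {p} e = colour⇒parity (n + j) (subst (λ y → y % 2 ≡ toℕ p) (+-suc n j) e)

cutᵛ : ∀ {p n m i} → i < n → parity (i + m) ≡ p ⁻¹ → Cut p n m
cutᵛ {m = m} {i} i<n e = inj₁ (i , i<n , parity⇒colour (i + m) e)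

cutʰ : ∀ {p n m j} → j < m → parity (n + j) ≡ p ⁻¹ → Cut p n m
cutʰ {p} {n} {j = j} j<m e =
  inj₂ (j , j<m , subst (λ y → y % 2 ≡ toℕ p) (sym (+-suc n j)) (parity⇒colour (n + j) e))

targetParity : ∀ {p n m} (c : Cut p n m) → parity (targetIndex c) ≡ p ⁻¹
targetParity {m = m} (inj₁ (i , _ , col)) = trans (chocIndex-parity i m) (colour⇒parity (i + m) col)
targetParity {n = n} (inj₂ (j , _ , col)) = trans (chocIndex-parity n j) (colourʰ⇒parity n j col)

targetIndex-< : ∀ {p n m} (c : Cut p n m) → parity (chocIndex n m) ≡ p ⁻¹ →
                targetIndex c < chocIndex n m
targetIndex-< {n = n} {m} (inj₁ (i , i<n , col)) e =
  chocIndex-<ˡ m i<n (trans (colour⇒parity (i + m) col) (trans (sym e) (chocIndex-parity n m)))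
targetIndex-< {n = n} {m} (inj₂ (j , j<m , col)) e =
  chocIndex-<ʳ n j<m (trans (colourʰ⇒parity n j col) (trans (sym e) (chocIndex-parity n m)))

cutTwo : ∀ {p} n m → parity (n + m) ≡ p ⁻¹ → toℕ (parity (n + m)) < chocIndex n m →
         Σ (Cut p n m) λ c → chocIndex n m ≡ 2 + targetIndex c
cutTwo (suc (suc n)) m e _ = cutᵛ (m<n⇒m<1+n (n<1+n n)) e , chocIndex-+2ˡ n m
cutTwo n (suc (suc m)) e _ =
  cutʰ (m<n⇒m<1+n (n<1+n m)) (trans (sym (cong parity n+2+m≡2+n+m)) e) , chocIndex-+2ʳ n m
  where
  n+2+m≡2+n+m : n + suc (suc m) ≡ suc (suc (n + m))
  n+2+m≡2+n+m = trans (+-suc n (suc m)) (cong suc (+-suc n m))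
cutTwo zero zero _ ()
cutTwo zero (suc zero) _ (s≤s ())
cutTwo (suc zero) zero _ (s≤s ())
cutTwo (suc zero) (suc zero) _ ()

cutOneᵛ : ∀ {p} n m → parity n ≡ 0ℙ ⊎ parity m ≡ 0ℙ → parity (suc n + m) ≡ p →
          Σ (Cut p (suc n) m) λ c → chocIndex (suc n) m ≤ 2 + targetIndex c
cutOneᵛ n m h e = cutᵛ (n<1+n n) (parity-pred (n + m) e) , m≤n⇒m≤1+n (chocIndex-sucˡ-≤ n m h)

cutOneʰ : ∀ {p} n m → parity n ≡ 0ℙ ⊎ parity m ≡ 0ℙ → parity (n + suc m) ≡ p →
          Σ (Cut p n (suc m)) λ c → chocIndex n (suc m) ≤ 2 + targetIndex c
cutOneʰ n m h e =
  cutʰ (n<1+n m) (parity-pred (n + m) (trans (cong parity (sym (+-suc n m))) e)) ,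
  m≤n⇒m≤1+n (chocIndex-sucʳ-≤ n m h)

cutOne : ∀ {p} n m → parity (n + m) ≡ p → 0 < chocIndex n m →
         Σ (Cut p n m) λ c → chocIndex n m ≤ 2 + targetIndex c
cutOne zero zero _ ()
cutOne zero (suc m) e _ = cutOneʰ zero m (inj₁ refl) e
cutOne (suc n) m e _ with parity-cases n m
... | inj₁ h = cutOneᵛ n m h e
cutOne (suc n) zero e _ | inj₂ (_ , ())
cutOne (suc n) (suc m) e _ | inj₂ (pn , _) =
  cutOneʰ (suc n) m (inj₁ (trans (parity-suc n) (cong _⁻¹ pn))) e

goodCut : ∀ p n m → toℕ (p ⁻¹) < chocIndex n m →
          Σ (Cut p n m) λ c → parity (targetIndex c) ≡ p ⁻¹ × chocIndex n m ≤ 2 + targetIndex c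
goodCut p n m lt with parity (n + m) ≟ p
... | yes e =
  let c , V≤2+w = cutOne n m e (≤-<-trans z≤n lt)
  in  c , targetParity c , V≤2+w
... | no ne =
  let e = ≢⇒≡⁻¹ ne
      c , V≡2+w = cutTwo n m e (subst (λ q → toℕ q < chocIndex n m) (sym e) lt)
  in  c , targetParity c , ≤-reflexive V≡2+w

chocF-∼H : ∀ f n m → n + m < f → chocF f n m ∼H chocIndex n m
chocF-∼H (suc f) n m (s≤s n+m≤f) =
  ∼H-intro (targetIndex {1ℙ}) (targetIndex {0ℙ})
    (λ { (inj₁ (i , i<n , _)) → chocF-∼H f i m (fuelᵛ i<n)
       ; (inj₂ (j , j<m , _)) → chocF-∼H f n j (fuelʰ j<m) })
    (λ { (inj₁ (i , i<n , _)) → chocF-∼H f i m (fuelᵛ i<n)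
       ; (inj₂ (j , j<m , _)) → chocF-∼H f n j (fuelʰ j<m) })
    (λ c → even⋢ (targetParity c) (targetIndex-< c))
    (λ c → odd⋢ (targetParity c) (targetIndex-< c))
    (goodCut 1ℙ n m)
    (goodCut 0ℙ n m)
  where
  fuelᵛ : ∀ {i} → i < n → i + m < f
  fuelᵛ i<n = <-≤-trans (+-monoˡ-< m i<n) n+m≤f
  fuelʰ : ∀ {j} → j < m → n + j < f
  fuelʰ j<m = <-≤-trans (+-monoʳ-< n j<m) n+m≤f

chocolate-∼H : ∀ n m → chocolate n m ∼H chocIndex n m
chocolate-∼H n m = chocF-∼H (suc (n + m)) n m ≤-refl

theorem6 : (n m : ℕ) →
    ((n % 2 ≡ 0 ⊎ m % 2 ≡ 0) → chocolate n m ≈G H (n + m)) ×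
    ((n % 2 ≡ 1 × m % 2 ≡ 1) → chocolate n m ≈G H (n + m ∸ 2))
theorem6 n m =
  (λ h → chocolate≈H (chocIndex-≡+ n m (Sum.map (%2⇒parity n) (%2⇒parity m) h))) ,
  (λ (hn , hm) → chocolate≈H (chocIndex-≡+∸2 n m (%2⇒parity n hn) (%2⇒parity m hm)))
  where
  chocolate≈H : ∀ {k} → chocIndex n m ≡ k → chocolate n m ≈G H k
  chocolate≈H refl = ∼H-≈G (chocolate-∼H n m) (H-∼H (chocIndex n m))
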